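{- Let $H=(V,E)$ be a hypergraph and $x$ a basic fractional matching of $H$ which is reduced. Let $B$ be the set of tight vertices of $x$. Then for every set of edges $L\subseteq E$, $|L|\le |B(L)|$, where $B(L)=\bigcup_{e\in L}(e\cap B)$.
   Context: A hypergraph $H=(V,E)$ has finite vertex set $V$ and a finite set $E$ of nonempty subsets of $V$. A fractional matching of $H$ is $x:E\to[0,1]$ with $\sum_{e\ni v}x(e)\le 1$ for all $v\in V$; it is basic if it is an extreme point of the fractional matching polytope. A vertex $v$ is tight if $\sum_{e\ni v}x(e)=1$. $x$ is reduced if $x(e)\in(0,1)$ for all $e\in E$.
   Formalization: The fractional matching x takes rational values, and basic means extreme among rational fractional matchings with rational convex-combination coefficients. -}

module Defs where

open import Data.Nat using (ℕ; zero; suc)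
open import Data.Bool using (if_then_else_)
open import Data.Fin using (Fin)
open import Data.Fin.Subset using (Subset; _∈_; _∩_; ⋃; Nonempty)
open import Data.Fin.Subset.Properties using (_∈?_)
open import Data.List using (List; map; filter; allFin)
open import Data.Rational using (ℚ; 0ℚ; 1ℚ; _+_; _*_; _-_; _≤_; _<_)
open import Data.Rational.Properties using (_≟_)
open import Data.Product using (_×_)
open import Data.Vec using (tabulate)
open import Relation.Nullary using (does; ¬_)
open import Relation.Binary.PropositionalEquality using (_≡_)
open import Function.Definitions using (Injective)

-- A hypergraph H = (V,E) with V = Fin n and E indexed by Fin m:
-- each edge is a nonempty subset of V, and edges are pairwise distinct
-- (E is a set of subsets).
record Hypergraph (n m : ℕ) : Set where
  field
    edge     : Fin m → Subset n
    nonempty : ∀ e → Nonempty (edge e)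
    distinct : Injective _≡_ _≡_ edge
open Hypergraph public

∑ : ∀ {m} → (Fin m → ℚ) → ℚ
∑ {zero}  f = 0ℚ
∑ {suc m} f = f Fin.zero + ∑ (λ i → f (Fin.suc i))

load : ∀ {n m} → Hypergraph n m → (Fin m → ℚ) → Fin n → ℚ
load H x v = ∑ (λ e → if does (v ∈? edge H e) then x e else 0ℚ)

IsFractionalMatching : ∀ {n m} → Hypergraph n m → (Fin m → ℚ) → Set
IsFractionalMatching H x =
  (∀ e → (0ℚ ≤ x e) × (x e ≤ 1ℚ)) × (∀ v → load H x v ≤ 1ℚ)

-- x is basic: an extreme point of the fractional matching polytope, i.e.
-- not a proper convex combination of two distinct fractional matchings
IsBasic : ∀ {n m} → Hypergraph n m → (Fin m → ℚ) → Set
IsBasic H x = IsFractionalMatching H x ×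
  (∀ (y z : Fin _ → ℚ) (t : ℚ) →
     IsFractionalMatching H y → IsFractionalMatching H z →
     0ℚ < t → t < 1ℚ →
     (∀ e → x e ≡ t * y e + (1ℚ - t) * z e) →
     ∀ e → y e ≡ z e)

IsReduced : ∀ {n m} → Hypergraph n m → (Fin m → ℚ) → Set
IsReduced H x = ∀ e → (0ℚ < x e) × (x e < 1ℚ)

tight : ∀ {n m} → Hypergraph n m → (Fin m → ℚ) → Subset n
tight H x = tabulate (λ v → does (load H x v ≟ 1ℚ))

B[_] : ∀ {n m} → Hypergraph n m → (Fin m → ℚ) → Subset m → Subset n
B[_] H x L = ⋃ (map (λ e → edge H e ∩ tight H x) (filter (_∈? L) (allFin _)))

-- If |B(L)| < |L|, the conditions "load d v = 0 for v ∈ B(L)" and "d e = 0 for e ∉ L" are fewer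
-- than |E| homogeneous linear equations, so they have a nonzero rational solution d. Such a d
-- leaves the load of every tight vertex unchanged: a tight vertex outside B(L) lies on no edge
-- of L. As x is reduced, x ± εd are then fractional matchings for small ε > 0, and x is their
-- midpoint, contradicting that x is basic.
module Submission where

open import Defs
open import Data.Nat using (ℕ; _≤_)
open import Data.Fin using (Fin)
open import Data.Fin.Subset using (Subset; ∣_∣)
open import Data.Rational using (ℚ)

import Data.Nat as ℕ
import Data.Nat.Properties as ℕ
open import Data.Bool using (true; false; if_then_else_)
open import Data.Empty using (⊥-elim)
open import Data.Fin using (zero; suc)
import Data.Fin.Properties as Fin
open import Data.Fin.Subset using (_∈_; ∁; ⋃; _∩_; inside; outside)
open import Data.Fin.Subset.Properties
  using (_∈?_; x∈p∪q⁺; x∈p∩q⁺; x∉p⇒x∈∁p; ∣∁p∣≡n∸∣p∣; ∣p∣≤n)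
open import Data.List using (List; []; _∷_; length; map; _++_)
import Data.List.Properties as List
open import Data.List.Relation.Unary.All as All using (All)
import Data.List.Relation.Unary.All.Properties as All
open import Data.List.Relation.Unary.Any as Any using (here; there; _─_)
import Data.List.Relation.Unary.Any.Properties as Any
open import Data.List.Membership.Propositional using () renaming (_∈_ to _∈ₗ_)
import Data.List.Membership.Propositional.Properties as Mem
open import Data.Product using (∃; _×_; _,_; proj₁; proj₂)
open import Data.Rational
  using (0ℚ; 1ℚ; ½; _+_; _*_; _-_; -_; _<_; 1/_; _⊓_; NonZero; Positive; ≢-nonZero;
         positive; nonNegative; nonPositive)
  renaming (_≤_ to _≤ℚ_)
open import Data.Rational.Properties
open import Data.Rational.Solver using (module +-*-Solver)
open import Data.Sum using (_⊎_; inj₁; inj₂; [_,_]′)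
open import Data.Vec.Functional using (tail)
import Data.Vec as Vec
import Data.Vec.Properties as Vec
open import Function using (_∘_; id)
open import Relation.Nullary using (¬_; yes; no; does)
open import Relation.Nullary.Decidable using (dec-true; toWitness)
open import Relation.Binary.PropositionalEquality
  using (_≡_; _≢_; refl; sym; trans; cong; cong₂; subst; module ≡-Reasoning)
open +-*-Solver

∑-cong : ∀ {m} {f g : Fin m → ℚ} → (∀ i → f i ≡ g i) → ∑ f ≡ ∑ g
∑-cong {ℕ.zero}  f≗g = refl
∑-cong {ℕ.suc m} f≗g = cong₂ _+_ (f≗g zero) (∑-cong (f≗g ∘ suc))

∑-zero : ∀ {m} {f : Fin m → ℚ} → (∀ i → f i ≡ 0ℚ) → ∑ f ≡ 0ℚ
∑-zero {ℕ.zero}  f≗0 = refl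
∑-zero {ℕ.suc m} f≗0 = cong₂ _+_ (f≗0 zero) (∑-zero (f≗0 ∘ suc))

∑-single : ∀ {m} (f : Fin m → ℚ) i → (∀ j → j ≢ i → f j ≡ 0ℚ) → ∑ f ≡ f i
∑-single {ℕ.suc m} f zero    f≗0 =
  trans (cong (f zero +_) (∑-zero (λ j → f≗0 (suc j) λ ())) ) (+-identityʳ (f zero))
∑-single {ℕ.suc m} f (suc i) f≗0 =
  trans (cong₂ _+_ (f≗0 zero λ ())
                   (∑-single (f ∘ suc) i λ j j≢i → f≗0 (suc j) (j≢i ∘ Fin.suc-injective)))
        (+-identityˡ (f (suc i)))

∑-linear : ∀ {m} (f g : Fin m → ℚ) c → ∑ (λ i → f i + c * g i) ≡ ∑ f + c * ∑ g
∑-linear {ℕ.zero}  f g c = sym (trans (+-identityˡ (c * 0ℚ)) (*-zeroʳ c))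
∑-linear {ℕ.suc m} f g c = begin
  f zero + c * g zero + ∑ (λ i → f (suc i) + c * g (suc i))
    ≡⟨ cong (f zero + c * g zero +_) (∑-linear (f ∘ suc) (g ∘ suc) c) ⟩
  f zero + c * g zero + (∑ (f ∘ suc) + c * ∑ (g ∘ suc))
    ≡⟨ solve 5 (λ a b c F G → (a :+ c :* b) :+ (F :+ c :* G) := (a :+ F) :+ c :* (b :+ G))
             refl (f zero) (g zero) c (∑ (f ∘ suc)) (∑ (g ∘ suc)) ⟩
  ∑ f + c * ∑ g ∎
  where open ≡-Reasoning

∑-neg : ∀ {m} (f : Fin m → ℚ) → ∑ (λ i → - f i) ≡ - ∑ f
∑-neg {ℕ.zero}  f = refl
∑-neg {ℕ.suc m} f =
  trans (cong (- f zero +_) (∑-neg (f ∘ suc))) (sym (neg-distrib-+ (f zero) (∑ (f ∘ suc))))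

infix 7 _·_

_·_ : ∀ {N} → (Fin N → ℚ) → (Fin N → ℚ) → ℚ
a · d = ∑ (λ i → a i * d i)

·-comm : ∀ {N} (a d : Fin N → ℚ) → a · d ≡ d · a
·-comm a d = ∑-cong (λ i → *-comm (a i) (d i))

unit : ∀ {N} → Fin N → Fin N → ℚ
unit i j = if does (i Fin.≟ j) then 1ℚ else 0ℚ

unit-· : ∀ {N} i (d : Fin N → ℚ) → unit i · d ≡ d i
unit-· i d = trans (∑-single (λ j → unit i j * d j) i off-i) at-i
  where
  off-i : ∀ j → j ≢ i → unit i j * d j ≡ 0ℚ
  off-i j j≢i with i Fin.≟ j
  ... | yes i≡j = ⊥-elim (j≢i (sym i≡j))
  ... | no _    = *-zeroˡ (d j)
  at-i : unit i i * d i ≡ d i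
  at-i with i Fin.≟ i
  ... | yes _   = *-identityˡ (d i)
  ... | no i≢i  = ⊥-elim (i≢i refl)

·-unit : ∀ {N} (a : Fin N → ℚ) i → a · unit i ≡ a i
·-unit a i = trans (·-comm a (unit i)) (unit-· i a)

module Elimination {N} (p : Fin (ℕ.suc N) → ℚ) .{{_ : NonZero (p zero)}} where

  reduce : (Fin (ℕ.suc N) → ℚ) → Fin N → ℚ
  reduce a i = tail a i + - (a zero * 1/ p zero) * tail p i

  lift : (Fin N → ℚ) → Fin (ℕ.suc N) → ℚ
  lift d zero    = - (1/ p zero * (tail p · d))
  lift d (suc i) = d i

  ·-lift : ∀ a d → a · lift d ≡ reduce a · d
  ·-lift a d = begin
    a zero * - (r * S) + tail a · d
      ≡⟨ solve 4 (λ a₀ r S T → a₀ :* (:- (r :* S)) :+ T := T :+ (:- (a₀ :* r)) :* S)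
               refl (a zero) r S (tail a · d) ⟩
    tail a · d + - (a zero * r) * S
      ≡⟨ sym (∑-linear (λ i → tail a i * d i) (λ i → tail p i * d i) (- (a zero * r))) ⟩
    ∑ (λ i → tail a i * d i + - (a zero * r) * (tail p i * d i))
      ≡⟨ ∑-cong (λ i → solve 4 (λ x c y z → x :* z :+ c :* (y :* z) := (x :+ c :* y) :* z)
                               refl (tail a i) (- (a zero * r)) (tail p i) (d i)) ⟩
    reduce a · d ∎
    where
    open ≡-Reasoning
    r = 1/ p zero
    S = tail p · d

  reduce-pivot : ∀ i → reduce p i ≡ 0ℚ
  reduce-pivot i = begin
    tail p i + - (p zero * 1/ p zero) * tail p i
      ≡⟨ cong (λ w → tail p i + - w * tail p i) (*-inverseʳ (p zero)) ⟩
    tail p i + - 1ℚ * tail p i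
      ≡⟨ solve 1 (λ y → y :+ (:- con 1ℚ) :* y := con 0ℚ) refl (tail p i) ⟩
    0ℚ ∎
    where open ≡-Reasoning

  pivot-·-lift : ∀ d → p · lift d ≡ 0ℚ
  pivot-·-lift d =
    trans (·-lift p d) (∑-zero λ i → trans (cong (_* d i) (reduce-pivot i)) (*-zeroˡ (d i)))

-- Gaussian elimination, pivoting on the first coordinate.
nontrivial-kernel : ∀ N (rows : List (Fin N → ℚ)) → length rows ℕ.< N →
  ∃ λ d → (∃ λ i → d i ≢ 0ℚ) × All (λ a → a · d ≡ 0ℚ) rows
nontrivial-kernel ℕ.zero    rows ()
nontrivial-kernel (ℕ.suc N) rows short with All.all? (λ a → a zero ≟ 0ℚ) rows
... | yes column-zero =
  unit zero , (zero , λ ()) , All.map (λ {a} a₀≡0 → trans (·-unit a zero) a₀≡0) column-zero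
... | no ¬column-zero =
  lift d , (suc i , d[i]≢0) ,
  All.─⁻ pivot (pivot-·-lift d) (All.map (λ {a} → trans (·-lift a d)) (All.map⁻ reduced-kernel))
  where
  pivot = All.¬All⇒Any¬ (λ a → a zero ≟ 0ℚ) rows ¬column-zero
  p = Any.lookup pivot
  instance
    p₀≢0 : NonZero (p zero)
    p₀≢0 = ≢-nonZero (Any.lookup-result pivot)
  open Elimination p
  shorter : length (map reduce (rows ─ pivot)) ℕ.< N
  shorter rewrite List.length-map reduce (rows ─ pivot) =
    ℕ.≤-pred (subst (ℕ._< ℕ.suc N) (List.length-removeAt′ rows (Any.index pivot)) short)
  kernel = nontrivial-kernel N (map reduce (rows ─ pivot)) shorter
  d = proj₁ kernel
  i = proj₁ (proj₁ (proj₂ kernel))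
  d[i]≢0 = proj₂ (proj₁ (proj₂ kernel))
  reduced-kernel = proj₂ (proj₂ kernel)

ForSmall : (ℚ → Set) → Set
ForSmall P = ∃ λ ε → 0ℚ < ε × (∀ η → 0ℚ ≤ℚ η → η ≤ℚ ε → P η)

ForSmall-map : ∀ {P Q : ℚ → Set} → (∀ η → P η → Q η) → ForSmall P → ForSmall Q
ForSmall-map P⇒Q (ε , 0<ε , small) = ε , 0<ε , λ η 0≤η η≤ε → P⇒Q η (small η 0≤η η≤ε)

ForSmall-× : ∀ {P Q : ℚ → Set} → ForSmall P → ForSmall Q → ForSmall (λ η → P η × Q η)
ForSmall-× (ε₁ , 0<ε₁ , P-small) (ε₂ , 0<ε₂ , Q-small) =
  ε₁ ⊓ ε₂ , 0<ε₁⊓ε₂ , λ η 0≤η η≤ε₁⊓ε₂ →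
    P-small η 0≤η (≤-trans η≤ε₁⊓ε₂ (p⊓q≤p ε₁ ε₂)) ,
    Q-small η 0≤η (≤-trans η≤ε₁⊓ε₂ (p⊓q≤q ε₁ ε₂))
  where
  0<ε₁⊓ε₂ : 0ℚ < ε₁ ⊓ ε₂
  0<ε₁⊓ε₂ = [ (λ eq → subst (0ℚ <_) (sym eq) 0<ε₁) , (λ eq → subst (0ℚ <_) (sym eq) 0<ε₂) ]′
              (⊓-sel ε₁ ε₂)

ForSmall-∀ : ∀ {k} {P : Fin k → ℚ → Set} → (∀ i → ForSmall (P i)) → ForSmall (λ η → ∀ i → P i η)
ForSmall-∀ {ℕ.zero}  _     = 1ℚ , positive⁻¹ 1ℚ , λ _ _ _ ()
ForSmall-∀ {ℕ.suc k} small =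
  ForSmall-map (λ { _ (P₀ , Pₛ) zero → P₀ ; _ (P₀ , Pₛ) (suc i) → Pₛ i })
               (ForSmall-× (small zero) (ForSmall-∀ (small ∘ suc)))

-- A constraint η * c ≤ g with slack g ≥ 0 survives small η unless it is tight (g = 0) and
-- actually moved (c ≠ 0).
ForSmall-*≤ : ∀ {c g} → 0ℚ ≤ℚ g → c ≡ 0ℚ ⊎ 0ℚ < g → ForSmall (λ η → η * c ≤ℚ g)
ForSmall-*≤ {c} {g} 0≤g c≡0∨0<g with c ≤? 0ℚ
... | yes c≤0 = 1ℚ , positive⁻¹ 1ℚ , λ η 0≤η _ → ≤-trans (η*c≤0 0≤η) 0≤g
  where
  η*c≤0 : ∀ {η} → 0ℚ ≤ℚ η → η * c ≤ℚ 0ℚ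
  η*c≤0 {η} 0≤η = nonPositive⁻¹ (η * c)
    {{nonNeg*nonPos⇒nonPos η {{nonNegative 0≤η}} c {{nonPositive c≤0}}}}
... | no c≰0 = g * 1/ c , positive⁻¹ (g * 1/ c) {{pos*pos⇒pos g (1/ c) {{1/pos⇒pos c}}}} ,
  λ η _ η≤g/c → begin
    η * c          ≤⟨ *-monoʳ-≤-nonNeg c {{pos⇒nonNeg c}} η≤g/c ⟩
    g * 1/ c * c   ≡⟨ *-assoc g (1/ c) c ⟩
    g * (1/ c * c) ≡⟨ cong (g *_) (*-inverseˡ c) ⟩
    g * 1ℚ         ≡⟨ *-identityʳ g ⟩
    g              ∎
  where
  open ≤-Reasoning
  0<c : 0ℚ < c
  0<c = ≰⇒> c≰0
  instance
    c-pos : Positive c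
    c-pos = positive 0<c
    c≢0 : NonZero c
    c≢0 = pos⇒nonZero c
    g-pos : Positive g
    g-pos = positive ([ (λ c≡0 → ⊥-elim (<-irrefl (sym c≡0) 0<c)) , id ]′ c≡0∨0<g)

p≤q⇒0≤q-p : ∀ {p q} → p ≤ℚ q → 0ℚ ≤ℚ q - p
p≤q⇒0≤q-p {p} p≤q = ≤-trans (≤-reflexive (sym (+-inverseʳ p))) (+-monoˡ-≤ (- p) p≤q)

p<q⇒0<q-p : ∀ {p q} → p < q → 0ℚ < q - p
p<q⇒0<q-p {p} p<q = ≤-<-trans (≤-reflexive (sym (+-inverseʳ p))) (+-monoˡ-< (- p) p<q)

q≤r-p⇒p+q≤r : ∀ p {q r} → q ≤ℚ r - p → p + q ≤ℚ r
q≤r-p⇒p+q≤r p {q} {r} q≤r-p =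
  ≤-trans (+-monoʳ-≤ p q≤r-p) (≤-reflexive (solve 2 (λ p r → p :+ (r :- p) := r) refl p r))

-q≤p⇒0≤p+q : ∀ {p q} → - q ≤ℚ p → 0ℚ ≤ℚ p + q
-q≤p⇒0≤p+q {p} {q} -q≤p = ≤-trans (≤-reflexive (sym (+-inverseˡ q))) (+-monoˡ-≤ q -q≤p)

≤∧≢⇒< : ∀ {p q} → p ≤ℚ q → p ≢ q → p < q
≤∧≢⇒< {p} {q} p≤q p≢q with q ≤? p
... | yes q≤p = ⊥-elim (p≢q (≤-antisym p≤q q≤p))
... | no q≰p  = ≰⇒> q≰p

p*q≡0⇒q≡0 : ∀ p .{{_ : NonZero p}} {q} → p * q ≡ 0ℚ → q ≡ 0ℚ
p*q≡0⇒q≡0 p {q} p*q≡0 = begin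
  q              ≡⟨ sym (*-identityˡ q) ⟩
  1ℚ * q         ≡⟨ cong (_* q) (sym (*-inverseˡ p)) ⟩
  1/ p * p * q   ≡⟨ *-assoc (1/ p) p q ⟩
  1/ p * (p * q) ≡⟨ cong (1/ p *_) p*q≡0 ⟩
  1/ p * 0ℚ      ≡⟨ *-zeroʳ (1/ p) ⟩
  0ℚ             ∎
  where open ≡-Reasoning

module _ {n m} (H : Hypergraph n m) where

  incidence : Fin n → Fin m → ℚ
  incidence v e = if does (v ∈? edge H e) then 1ℚ else 0ℚ

  incidence-· : ∀ v d → incidence v · d ≡ load H d v
  incidence-· v d = ∑-cong λ e → masked (does (v ∈? edge H e)) (d e)
    where
    masked : ∀ b a → (if b then 1ℚ else 0ℚ) * a ≡ (if b then a else 0ℚ)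
    masked true  a = *-identityˡ a
    masked false a = *-zeroˡ a

  load-linear : ∀ x d c v → load H (λ e → x e + c * d e) v ≡ load H x v + c * load H d v
  load-linear x d c v =
    trans (∑-cong λ e → masked (does (v ∈? edge H e)) (x e) (d e))
          (∑-linear (λ e → if does (v ∈? edge H e) then x e else 0ℚ)
                    (λ e → if does (v ∈? edge H e) then d e else 0ℚ) c)
    where
    masked : ∀ b a g → (if b then a + c * g else 0ℚ) ≡ (if b then a else 0ℚ) + c * (if b then g else 0ℚ)
    masked true  a g = refl
    masked false a g = sym (trans (+-identityˡ (c * 0ℚ)) (*-zeroʳ c))

  load-neg : ∀ d v → load H (λ e → - d e) v ≡ - load H d v
  load-neg d v =
    trans (∑-cong λ e → masked (does (v ∈? edge H e)) (d e))
          (∑-neg (λ e → if does (v ∈? edge H e) then d e else 0ℚ))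
    where
    masked : ∀ b a → (if b then - a else 0ℚ) ≡ - (if b then a else 0ℚ)
    masked true  a = refl
    masked false a = refl

  perturbed-matching : ∀ {x d} → (∀ v → load H x v ≤ℚ 1ℚ) → IsReduced H x →
    (∀ v → load H x v ≡ 1ℚ → load H d v ≡ 0ℚ) →
    ForSmall (λ η → IsFractionalMatching H (λ e → x e + η * d e))
  perturbed-matching {x} {d} x-bounded x-reduced d-tight =
    ForSmall-map matching (ForSmall-× (ForSmall-∀ edge-slack) (ForSmall-∀ vertex-slack))
    where
    edge-slack : ∀ e → ForSmall (λ η → η * - d e ≤ℚ x e × η * d e ≤ℚ 1ℚ - x e)
    edge-slack e = ForSmall-× (ForSmall-*≤ (<⇒≤ 0<x) (inj₂ 0<x)) (ForSmall-*≤ (<⇒≤ 0<1-x) (inj₂ 0<1-x))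
      where
      0<x = proj₁ (x-reduced e)
      0<1-x = p<q⇒0<q-p (proj₂ (x-reduced e))
    vertex-slack : ∀ v → ForSmall (λ η → η * load H d v ≤ℚ 1ℚ - load H x v)
    vertex-slack v with load H x v ≟ 1ℚ
    ... | yes tight = ForSmall-*≤ (p≤q⇒0≤q-p (x-bounded v)) (inj₁ (d-tight v tight))
    ... | no loose  = ForSmall-*≤ (p≤q⇒0≤q-p (x-bounded v)) (inj₂ (p<q⇒0<q-p (≤∧≢⇒< (x-bounded v) loose)))
    matching : ∀ η → (∀ e → η * - d e ≤ℚ x e × η * d e ≤ℚ 1ℚ - x e) ×
                       (∀ v → η * load H d v ≤ℚ 1ℚ - load H x v) →
               IsFractionalMatching H (λ e → x e + η * d e)
    matching η (edges , vertices) =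
      (λ e → -q≤p⇒0≤p+q (≤-trans (≤-reflexive (neg-distribʳ-* η (d e))) (proj₁ (edges e))) ,
             q≤r-p⇒p+q≤r (x e) (proj₂ (edges e))) ,
      (λ v → subst (_≤ℚ 1ℚ) (sym (load-linear x d η v)) (q≤r-p⇒p+q≤r (load H x v) (vertices v)))

  basic-reduced-rigid : ∀ {x d} → IsBasic H x → IsReduced H x →
    (∀ v → load H x v ≡ 1ℚ → load H d v ≡ 0ℚ) → ∀ e → d e ≡ 0ℚ
  basic-reduced-rigid {x} {d} (x-matching , x-extreme) x-reduced d-tight e = p*q≡0⇒q≡0 ε ε*d[e]≡0
    where
    -d-tight : ∀ v → load H x v ≡ 1ℚ → load H (λ e → - d e) v ≡ 0ℚ
    -d-tight v tight = trans (load-neg d v) (cong -_ (d-tight v tight))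
    both = ForSmall-× (perturbed-matching (proj₂ x-matching) x-reduced d-tight)
                      (perturbed-matching (proj₂ x-matching) x-reduced -d-tight)
    ε = proj₁ both
    0<ε = proj₁ (proj₂ both)
    matchings = proj₂ (proj₂ both) ε (<⇒≤ 0<ε) ≤-refl
    instance
      ε≢0 : NonZero ε
      ε≢0 = pos⇒nonZero ε {{positive 0<ε}}
    y z : Fin m → ℚ
    y i = x i + ε * d i
    z i = x i + ε * - d i
    midpoint : ∀ i → x i ≡ ½ * y i + (1ℚ - ½) * z i
    midpoint i = solve 3 (λ a ε b → a := con ½ :* (a :+ ε :* b) :+ (con 1ℚ :- con ½) :* (a :+ ε :* (:- b)))
                         refl (x i) ε (d i)
    y≡z : y e ≡ z e
    y≡z = x-extreme y z ½ (proj₁ matchings) (proj₂ matchings)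
                    (positive⁻¹ ½) (toWitness {a? = ½ <? 1ℚ} _) midpoint e
    ε*d[e]≡0 : ε * d e ≡ 0ℚ
    ε*d[e]≡0 = begin
      ε * d e         ≡⟨ solve 3 (λ a ε b → ε :* b := con ½ :* ((a :+ ε :* b) :- (a :+ ε :* (:- b))))
                               refl (x e) ε (d e) ⟩
      ½ * (y e - z e) ≡⟨ cong (λ w → ½ * (w - z e)) y≡z ⟩
      ½ * (z e - z e) ≡⟨ solve 1 (λ w → con ½ :* (w :- w) := con 0ℚ) refl (z e) ⟩
      0ℚ              ∎
      where open ≡-Reasoning

elements : ∀ {n} → Subset n → List (Fin n)
elements Vec.[]            = []
elements (inside Vec.∷ S)  = zero ∷ map suc (elements S)
elements (outside Vec.∷ S) = map suc (elements S)

length-elements : ∀ {n} (S : Subset n) → length (elements S) ≡ ∣ S ∣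
length-elements Vec.[]            = refl
length-elements (inside Vec.∷ S)  = cong ℕ.suc (trans (List.length-map suc (elements S)) (length-elements S))
length-elements (outside Vec.∷ S) = trans (List.length-map suc (elements S)) (length-elements S)

∈-elements : ∀ {n} {S : Subset n} {i} → i ∈ S → i ∈ₗ elements S
∈-elements {S = inside Vec.∷ S}  Vec.here          = here refl
∈-elements {S = inside Vec.∷ S}  (Vec.there i∈S)  = there (Mem.∈-map⁺ suc (∈-elements i∈S))
∈-elements {S = outside Vec.∷ S} (Vec.there i∈S)  = Mem.∈-map⁺ suc (∈-elements i∈S)

∈-⋃⁺ : ∀ {n} {S : Subset n} {Ss i} → S ∈ₗ Ss → i ∈ S → i ∈ ⋃ Ss
∈-⋃⁺ (here refl) i∈S = x∈p∪q⁺ (inj₁ i∈S)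
∈-⋃⁺ (there S∈Ss) i∈S = x∈p∪q⁺ (inj₂ (∈-⋃⁺ S∈Ss i∈S))

module _ {n m} (H : Hypergraph n m) (x : Fin m → ℚ) where

  ∈-tight⁺ : ∀ {v} → load H x v ≡ 1ℚ → v ∈ tight H x
  ∈-tight⁺ {v} v-tight =
    Vec.lookup⇒[]= v _ (trans (Vec.lookup∘tabulate _ v) (dec-true (load H x v ≟ 1ℚ) v-tight))

  ∈-B[]⁺ : ∀ {L v e} → e ∈ L → v ∈ edge H e → v ∈ tight H x → v ∈ B[ H ] x L
  ∈-B[]⁺ {L} {e = e} e∈L v∈e v∈tight =
    ∈-⋃⁺ (Mem.∈-map⁺ (λ e → edge H e ∩ tight H x) (Mem.∈-filter⁺ (_∈? L) (Mem.∈-allFin e) e∈L))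
         (x∈p∩q⁺ (v∈e , v∈tight))

  module _ (L : Subset m) where

    -- Incidence rows encode load d v = 0 for v ∈ B(L); unit rows encode d e = 0 for e ∉ L.
    rows : List (Fin m → ℚ)
    rows = map (incidence H) (elements (B[ H ] x L)) ++ map unit (elements (∁ L))

    length-rows : length rows ≡ ∣ B[ H ] x L ∣ ℕ.+ (m ℕ.∸ ∣ L ∣)
    length-rows = begin
      length rows
        ≡⟨ List.length-++ (map (incidence H) (elements (B[ H ] x L))) ⟩
      length (map (incidence H) (elements (B[ H ] x L))) ℕ.+ length (map unit (elements (∁ L)))
        ≡⟨ cong₂ ℕ._+_ (List.length-map (incidence H) (elements (B[ H ] x L))) (List.length-map unit (elements (∁ L))) ⟩
      length (elements (B[ H ] x L)) ℕ.+ length (elements (∁ L))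
        ≡⟨ cong₂ ℕ._+_ (length-elements (B[ H ] x L)) (trans (length-elements (∁ L)) (∣∁p∣≡n∸∣p∣ L)) ⟩
      ∣ B[ H ] x L ∣ ℕ.+ (m ℕ.∸ ∣ L ∣) ∎
      where open ≡-Reasoning

    module _ {d : Fin m → ℚ} (d∈kernel : All (λ a → a · d ≡ 0ℚ) rows) where

      kernel-load-B[] : ∀ {v} → v ∈ B[ H ] x L → load H d v ≡ 0ℚ
      kernel-load-B[] {v} v∈B = trans (sym (incidence-· H v d))
        (All.lookup (All.map⁻ (proj₁ (All.++⁻ _ d∈kernel))) (∈-elements v∈B))

      kernel-outside-L : ∀ {e} → e ∈ ∁ L → d e ≡ 0ℚ
      kernel-outside-L {e} e∈∁L = trans (sym (unit-· e d))
        (All.lookup (All.map⁻ (proj₂ (All.++⁻ _ d∈kernel))) (∈-elements e∈∁L))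

      kernel-load-tight : ∀ v → load H x v ≡ 1ℚ → load H d v ≡ 0ℚ
      kernel-load-tight v v-tight with v ∈? B[ H ] x L
      ... | yes v∈B = kernel-load-B[] v∈B
      ... | no v∉B  = ∑-zero on-edge
        where
        on-edge : ∀ e → (if does (v ∈? edge H e) then d e else 0ℚ) ≡ 0ℚ
        on-edge e with v ∈? edge H e
        ... | no _ = refl
        ... | yes v∈e with e ∈? L
        ...   | yes e∈L = ⊥-elim (v∉B (∈-B[]⁺ e∈L v∈e (∈-tight⁺ v-tight)))
        ...   | no e∉L  = kernel-outside-L (x∉p⇒x∈∁p e∉L)

    B[]-not-deficient : IsBasic H x → IsReduced H x → ¬ ∣ B[ H ] x L ∣ ℕ.< ∣ L ∣
    B[]-not-deficient basic reduced deficient =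
      d[i]≢0 (basic-reduced-rigid H basic reduced (kernel-load-tight d∈kernel) i)
      where
      fewer-rows : length rows ℕ.< m
      fewer-rows = begin-strict
        length rows                      ≡⟨ length-rows ⟩
        ∣ B[ H ] x L ∣ ℕ.+ (m ℕ.∸ ∣ L ∣) <⟨ ℕ.+-monoˡ-< (m ℕ.∸ ∣ L ∣) deficient ⟩
        ∣ L ∣ ℕ.+ (m ℕ.∸ ∣ L ∣)          ≡⟨ ℕ.m+[n∸m]≡n (∣p∣≤n L) ⟩
        m                                ∎
        where open ℕ.≤-Reasoning
      kernel = nontrivial-kernel m rows fewer-rows
      d = proj₁ kernel
      i = proj₁ (proj₁ (proj₂ kernel))
      d[i]≢0 = proj₂ (proj₁ (proj₂ kernel))
      d∈kernel = proj₂ (proj₂ kernel)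

proposition12 : ∀ {n m} (H : Hypergraph n m) (x : Fin m → ℚ) →
    IsBasic H x → IsReduced H x →
    ∀ (L : Subset m) → ∣ L ∣ ≤ ∣ B[_] H x L ∣
proposition12 H x basic reduced L = ℕ.≮⇒≥ (B[]-not-deficient H x L basic reduced)
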